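{- Let $w=w_1\cdots w_n\in\mathfrak{S}_n$ and let the section $w_i\cdots w_j$ of $w$ be $k$-ascending. (1) If there is $t>j$ with $w_j<w_t$ such that the section $w_j\cdots w_t$ contains no $k$-down, then there is $t'$ with $j<t'\le t$ such that $w_i\cdots w_j\cdots w_{t'}$ is $k$-ascending. (2) If there is $s<i$ with $w_s<w_i$ such that the section $w_s\cdots w_i$ contains no $k$-down, then there is $s'$ with $s\le s'<i$ such that $w_{s'}\cdots w_i\cdots w_j$ is $k$-ascending.
   Context: Let $n\ge2$, $1\le k\le n-1$, and $\mathfrak S_n$ the permutations of $\{1,\dots,n\}$ in one-line notation $w=w_1\cdots w_n$. A section of $w$ is a consecutive segment $w_sw_{s+1}\cdots w_t$. A section $w_s\cdots w_t$ is a $k$-up if $s<t$ and $w_t-w_s\ge k$, and a $k$-down if $s<t$ and $w_s-w_t\ge k$. A section $w_a\cdots w_b$ contains a $k$-down if there are $a\le s<t\le b$ with $w_s-w_t\ge k$ (similarly for $k$-up). A section $w_i\cdots w_j$ with $i<j$ is $k$-ascending if (1) $w_i=\min\{w_i,\dots,w_j\}$ and $w_j=\max\{w_i,\dots,w_j\}$; (2) $w_j-w_i\ge k$; (3) there are no $i\le s<t\le j$ with $w_s-w_t\ge k$. -}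

module Defs where

open import Data.Nat using (ℕ; _+_; _≤_)
open import Data.Fin using (Fin; toℕ; _<_) renaming (_≤_ to _≤ᶠ_)
open import Data.Fin.Permutation using (Permutation′; _⟨$⟩ʳ_)
open import Data.Product using (Σ; _×_; ∃-syntax)
open import Relation.Nullary using (¬_)

-- A permutation w ∈ 𝔖_n, given as a bijection on Fin n.
-- Positions are Fin n (0-based); the value w_p is  toℕ (w ⟨$⟩ʳ p)
-- (0-based values; only differences and comparisons matter).
val : {n : ℕ} → Permutation′ n → Fin n → ℕ
val w p = toℕ (w ⟨$⟩ʳ p)

ContainsKDown : {n : ℕ} → Permutation′ n → ℕ → Fin n → Fin n → Set
ContainsKDown w k a b =
  ∃[ s ] ∃[ t ] (a ≤ᶠ s × s < t × t ≤ᶠ b × val w t + k ≤ val w s)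

KAscending : {n : ℕ} → Permutation′ n → ℕ → Fin n → Fin n → Set
KAscending w k i j =
  i < j
  × (∀ m → i ≤ᶠ m → m ≤ᶠ j → val w i ≤ val w m × val w m ≤ val w j)
  × val w i + k ≤ val w j
  × ¬ ContainsKDown w k i j

-- To extend w_i ⋯ w_j to the right, take the first t′ > j with w_t′ > w_j. Values strictly
-- between j and t′ are at most w_j, the maximum of w_i ⋯ w_j, so w_t′ is the new maximum; as
-- w_j ⋯ w_t has no k-down, every value after j exceeds w_j - k ≥ w_i, so w_i stays the minimum;
-- and a k-down straddling j is impossible since w_s ≤ w_j < w_u + k. The left extension is the
-- mirror image, using the last s′ < i with w_s′ < w_i.
module Submission where

open import Defs
open import Data.Nat using (ℕ; _≤_; _<_; suc; _+_)
open import Data.Nat.Properties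
  using (≤-refl; ≤-trans; <-trans; <⇒≤; ≤-<-trans; <-≤-trans; ≤-<-connex; <-irrefl;
         m≤n⇒m<n∨m≡n; ≮⇒≥; _<?_; +-cancelʳ-<; +-monoˡ-<; +-monoˡ-≤)
open import Data.Fin using (Fin; toℕ) renaming (_<_ to _<ᶠ_; _≤_ to _≤ᶠ_)
open import Data.Fin.Properties using (any?; toℕ-injective) renaming (_<?_ to _<ᶠ?_)
open import Data.Fin.Induction using (<-wellFounded; >-wellFounded)
open import Data.Fin.Permutation using (Permutation′)
open import Data.Product using (_×_; ∃-syntax; _,_; proj₁; proj₂)
open import Data.Sum using (inj₁; inj₂)
open import Data.Empty using (⊥-elim)
open import Function using (_∘_)
open import Induction.WellFounded using (Acc; acc)
open import Relation.Nullary using (¬_; yes; no; _×-dec_)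
open import Relation.Unary using (Pred; Decidable)
open import Relation.Binary.PropositionalEquality using (refl; subst)

module _ {n : ℕ} {p} {P : Pred (Fin n) p} (P? : Decidable P) where

  first-after : (j t : Fin n) → Acc _<ᶠ_ t → j <ᶠ t → P t →
    ∃[ t′ ] (j <ᶠ t′ × t′ ≤ᶠ t × P t′ × (∀ m → j <ᶠ m → m <ᶠ t′ → ¬ P m))
  first-after j t (acc rs) j<t Pt with any? (λ m → (j <ᶠ? m) ×-dec (m <ᶠ? t) ×-dec P? m)
  ... | no none = t , j<t , ≤-refl , Pt , λ m j<m m<t Pm → none (m , j<m , m<t , Pm)
  ... | yes (m , j<m , m<t , Pm) with first-after j m (rs m<t) j<m Pm
  ...   | t′ , j<t′ , t′≤m , Pt′ , before = t′ , j<t′ , ≤-trans t′≤m (<⇒≤ m<t) , Pt′ , before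

  last-before : (s i : Fin n) → Acc (λ x y → y <ᶠ x) s → s <ᶠ i → P s →
    ∃[ s′ ] (s ≤ᶠ s′ × s′ <ᶠ i × P s′ × (∀ m → s′ <ᶠ m → m <ᶠ i → ¬ P m))
  last-before s i (acc rs) s<i Ps with any? (λ m → (s <ᶠ? m) ×-dec (m <ᶠ? i) ×-dec P? m)
  ... | no none = s , ≤-refl , s<i , Ps , λ m s<m m<i Pm → none (m , s<m , m<i , Pm)
  ... | yes (m , s<m , m<i , Pm) with last-before m i (rs s<m) m<i Pm
  ...   | s′ , m≤s′ , s′<i , Ps′ , after = s′ , ≤-trans (<⇒≤ s<m) m≤s′ , s′<i , Ps′ , after

module _ {n : ℕ} (w : Permutation′ n) (k : ℕ) where

  containsKDown-widen : {a a′ b′ b : Fin n} → a ≤ᶠ a′ → b′ ≤ᶠ b →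
    ContainsKDown w k a′ b′ → ContainsKDown w k a b
  containsKDown-widen a≤a′ b′≤b (s , t , a′≤s , s<t , t≤b′ , down) =
    s , t , ≤-trans a≤a′ a′≤s , s<t , ≤-trans t≤b′ b′≤b , down

  ¬containsKDown⇒close : {a b s t : Fin n} → ¬ ContainsKDown w k a b →
    a ≤ᶠ s → s <ᶠ t → t ≤ᶠ b → val w s < val w t + k
  ¬containsKDown⇒close {s = s} {t} free a≤s s<t t≤b with ≤-<-connex (val w t + k) (val w s)
  ... | inj₁ down = ⊥-elim (free (s , t , a≤s , s<t , t≤b , down))
  ... | inj₂ close = close

  ¬containsKDown-join : {a m b : Fin n} →
    ¬ ContainsKDown w k a m → ¬ ContainsKDown w k m b →
    (∀ s u → a ≤ᶠ s → s <ᶠ m → m <ᶠ u → u ≤ᶠ b → val w s < val w u + k) →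
    ¬ ContainsKDown w k a b
  ¬containsKDown-join {m = m} left right straddle (s , u , a≤s , s<u , u≤b , down)
    with ≤-<-connex (toℕ u) (toℕ m) | ≤-<-connex (toℕ m) (toℕ s)
  ... | inj₁ u≤m | _ = left (s , u , a≤s , s<u , u≤m , down)
  ... | inj₂ m<u | inj₁ m≤s = right (s , u , m≤s , s<u , u≤b , down)
  ... | inj₂ m<u | inj₂ s<m = <-irrefl refl (<-≤-trans (straddle s u a≤s s<m m<u u≤b) down)

  extend-right : {i j t′ : Fin n} → KAscending w k i j → j <ᶠ t′ → val w j < val w t′ →
    (∀ m → j <ᶠ m → m <ᶠ t′ → val w m ≤ val w j) → ¬ ContainsKDown w k j t′ →
    KAscending w k i t′
  extend-right {i} {j} {t′} (i<j , bounds , rise , free) j<t′ wj<wt′ below free′ =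
    <-trans i<j j<t′ , bounds′ , ≤-trans rise (<⇒≤ wj<wt′) , free″
    where
    wi<after : ∀ m → j <ᶠ m → m ≤ᶠ t′ → val w i < val w m
    wi<after m j<m m≤t′ =
      +-cancelʳ-< k (val w i) (val w m) (≤-<-trans rise (¬containsKDown⇒close free′ ≤-refl j<m m≤t′))

    ≤wt′ : ∀ m → j <ᶠ m → m ≤ᶠ t′ → val w m ≤ val w t′
    ≤wt′ m j<m m≤t′ with m≤n⇒m<n∨m≡n m≤t′
    ... | inj₁ m<t′ = <⇒≤ (≤-<-trans (below m j<m m<t′) wj<wt′)
    ... | inj₂ m≡t′ = subst (λ x → val w m ≤ val w x) (toℕ-injective m≡t′) ≤-refl

    bounds′ : ∀ m → i ≤ᶠ m → m ≤ᶠ t′ → val w i ≤ val w m × val w m ≤ val w t′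
    bounds′ m i≤m m≤t′ with ≤-<-connex (toℕ m) (toℕ j)
    ... | inj₁ m≤j = let (lo , hi) = bounds m i≤m m≤j in lo , <⇒≤ (≤-<-trans hi wj<wt′)
    ... | inj₂ j<m = <⇒≤ (wi<after m j<m m≤t′) , ≤wt′ m j<m m≤t′

    free″ : ¬ ContainsKDown w k i t′
    free″ = ¬containsKDown-join free free′ λ s u i≤s s<j j<u u≤t′ →
      ≤-<-trans (proj₂ (bounds s i≤s (<⇒≤ s<j))) (¬containsKDown⇒close free′ ≤-refl j<u u≤t′)

  extend-left : {s′ i j : Fin n} → KAscending w k i j → s′ <ᶠ i → val w s′ < val w i →
    (∀ m → s′ <ᶠ m → m <ᶠ i → val w i ≤ val w m) → ¬ ContainsKDown w k s′ i →
    KAscending w k s′ j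
  extend-left {s′} {i} {j} (i<j , bounds , rise , free) s′<i ws′<wi above free′ =
    <-trans s′<i i<j , bounds′ , ≤-trans (<⇒≤ (+-monoˡ-< k ws′<wi)) rise , free″
    where
    before<wj : ∀ m → s′ ≤ᶠ m → m <ᶠ i → val w m < val w j
    before<wj m s′≤m m<i = <-≤-trans (¬containsKDown⇒close free′ s′≤m m<i ≤-refl) rise

    ws′≤ : ∀ m → s′ ≤ᶠ m → m <ᶠ i → val w s′ ≤ val w m
    ws′≤ m s′≤m m<i with m≤n⇒m<n∨m≡n s′≤m
    ... | inj₁ s′<m = <⇒≤ (<-≤-trans ws′<wi (above m s′<m m<i))
    ... | inj₂ s′≡m = subst (λ x → val w s′ ≤ val w x) (toℕ-injective s′≡m) ≤-refl

    bounds′ : ∀ m → s′ ≤ᶠ m → m ≤ᶠ j → val w s′ ≤ val w m × val w m ≤ val w j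
    bounds′ m s′≤m m≤j with ≤-<-connex (toℕ i) (toℕ m)
    ... | inj₁ i≤m = let (lo , hi) = bounds m i≤m m≤j in <⇒≤ (<-≤-trans ws′<wi lo) , hi
    ... | inj₂ m<i = ws′≤ m s′≤m m<i , <⇒≤ (before<wj m s′≤m m<i)

    free″ : ¬ ContainsKDown w k s′ j
    free″ = ¬containsKDown-join free′ free λ a u s′≤a a<i i<u u≤j →
      <-≤-trans (¬containsKDown⇒close free′ s′≤a a<i ≤-refl)
                (+-monoˡ-≤ k (proj₁ (bounds u (<⇒≤ i<u) u≤j)))

lemma2p4 : (n : ℕ) → 2 ≤ n → (k : ℕ) → 1 ≤ k → suc k ≤ n →
    (w : Permutation′ n) → (i j : Fin n) → KAscending w k i j →
    ((t : Fin n) → j <ᶠ t → val w j < val w t → ¬ ContainsKDown w k j t →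
       ∃[ t′ ] (j <ᶠ t′ × t′ ≤ᶠ t × KAscending w k i t′))
    × ((s : Fin n) → s <ᶠ i → val w s < val w i → ¬ ContainsKDown w k s i →
       ∃[ s′ ] (s ≤ᶠ s′ × s′ <ᶠ i × KAscending w k s′ j))
lemma2p4 n _ k _ _ w i j asc = rightward , leftward
  where
  rightward : (t : Fin n) → j <ᶠ t → val w j < val w t → ¬ ContainsKDown w k j t →
    ∃[ t′ ] (j <ᶠ t′ × t′ ≤ᶠ t × KAscending w k i t′)
  rightward t j<t wj<wt free
    with first-after (λ m → val w j <? val w m) j t (<-wellFounded t) j<t wj<wt
  ... | t′ , j<t′ , t′≤t , wj<wt′ , before =
    t′ , j<t′ , t′≤t ,
    extend-right w k asc j<t′ wj<wt′ (λ m j<m m<t′ → ≮⇒≥ (before m j<m m<t′))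
      (free ∘ containsKDown-widen w k ≤-refl t′≤t)

  leftward : (s : Fin n) → s <ᶠ i → val w s < val w i → ¬ ContainsKDown w k s i →
    ∃[ s′ ] (s ≤ᶠ s′ × s′ <ᶠ i × KAscending w k s′ j)
  leftward s s<i ws<wi free
    with last-before (λ m → val w m <? val w i) s i (>-wellFounded s) s<i ws<wi
  ... | s′ , s≤s′ , s′<i , ws′<wi , after =
    s′ , s≤s′ , s′<i ,
    extend-left w k asc s′<i ws′<wi (λ m s′<m m<i → ≮⇒≥ (after m s′<m m<i))
      (free ∘ containsKDown-widen w k s≤s′ ≤-refl)
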